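{- Let $\mathbb F_q$ be the finite field with $q$ elements, $q$ odd, and let $\eta$ be a multiplicative character of $\mathbb F_q^\times$ of order $N$ with $N\mid(q-1)$. For $z\in\mathbb F_q$ define $$F_\eta(z)=\sum_{x\in\mathbb F_q}\eta(x)\,(\phi\overline\eta)(x-1)\,(\phi\overline\eta)(x-z).$$ Then for every $z\in\mathbb F_q$ with $z\neq 1$, $$F_\eta(z)=\overline\eta(1-z)^2\,F_{\phi\overline\eta}(z).$$
   Context: All multiplicative characters of $\mathbb F_q^\times$ (including the trivial one) are extended to $\mathbb F_q$ by setting their value at $0$ equal to $0$. $\phi$ is the quadratic character of $\mathbb F_q^\times$ and $\overline\eta$ is the inverse (complex conjugate) of $\eta$; $F_{\phi\overline\eta}$ is defined by the same formula with $\eta$ replaced by $\phi\overline\eta$. -}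

module Defs where

open import Level using (Level; 0ℓ)
open import Data.Nat using (ℕ; zero; suc)
open import Data.Fin using (Fin)
import Data.Fin as Fin
open import Data.Fin.Properties using (any?)
open import Data.Product using (∃; _,_; proj₁)
open import Relation.Nullary using (¬_; yes; no; Dec)
open import Relation.Binary.PropositionalEquality using (_≡_; _≢_)
open import Relation.Binary.Definitions using (DecidableEquality)
open import Algebra.Structures using (IsCommutativeRing)
open import Algebra.Bundles using (CommutativeRing)
open import Function.Bundles using (_↔_; Inverse)

record FiniteField : Set₁ where
  infixl 7 _*_
  infixl 6 _+_ _-_
  field
    Carrier : Set
    _+_ _*_ : Carrier → Carrier → Carrier
    -_ : Carrier → Carrier
    0# 1# : Carrier
    isCommutativeRing : IsCommutativeRing _≡_ _+_ _*_ -_ 0# 1#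
    0≢1 : 0# ≢ 1#
    _⁻¹ : Carrier → Carrier
    ⁻¹-inverse : ∀ x → x ≢ 0# → x * (x ⁻¹) ≡ 1#
    ⁻¹-zero : 0# ⁻¹ ≡ 0#          -- convention only; used to extend by 0
    _≟_ : DecidableEquality Carrier
    q : ℕ
    enum : Carrier ↔ Fin q

  _-_ : Carrier → Carrier → Carrier
  x - y = x + (- y)

  elem : Fin q → Carrier
  elem = Inverse.from enum

module _ (F : FiniteField) (R : CommutativeRing 0ℓ 0ℓ) where
  private
    module F = FiniteField F
    module R = CommutativeRing R

  sumFin : (n : ℕ) → (Fin n → R.Carrier) → R.Carrier
  sumFin zero    f = R.0#
  sumFin (suc n) f = f Fin.zero R.+ sumFin n (λ i → f (Fin.suc i))

  sumF : (F.Carrier → R.Carrier) → R.Carrier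
  sumF f = sumFin F.q (λ i → f (F.elem i))

  record Character : Set where
    field
      χ     : F.Carrier → R.Carrier
      χ-0   : χ F.0# R.≈ R.0#
      χ-1   : χ F.1# R.≈ R.1#
      χ-mul : ∀ x y → χ (x F.* y) R.≈ χ x R.* χ y

  -- the inverse ("conjugate") of a function on F: χ̄(x) = χ(x⁻¹), χ̄(0) = χ(0)
  conj : (F.Carrier → R.Carrier) → F.Carrier → R.Carrier
  conj χ x = χ (x F.⁻¹)

  _·_ : (F.Carrier → R.Carrier) → (F.Carrier → R.Carrier) → F.Carrier → R.Carrier
  (χ · ψ) x = χ x R.* ψ x

  φ : F.Carrier → R.Carrier
  φ x with x F.≟ F.0#
  ... | yes _ = R.0#
  ... | no _ with any? (λ i → (F.elem i F.* F.elem i) F.≟ x)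
  ...   | yes _ = R.1#
  ...   | no _  = R.- R.1#

  Fη : (F.Carrier → R.Carrier) → F.Carrier → R.Carrier
  Fη η z = sumF (λ x → (η x R.* (φ · conj η) (x F.- F.1#)) R.* (φ · conj η) (x F.- z))

{-# OPTIONS --safe #-}
-- Substitute x = (y - z)/(y - 1), an involution of F ∖ {1} which we extend by 1 ↦ 1 (both
-- summands vanish there). Then x - 1 = (1 - z)/(y - 1) and x - z = y(1 - z)/(y - 1), so by
-- multiplicativity of η and of ψ = φη̄ the summand of F_η at x becomes
-- η̄(1 - z)² ψ(y) η(y - 1) η(y - z), which is η̄(1 - z)² times the summand of F_ψ at y because
-- φψ̄ = η. Multiplicativity of φ rests on the product of two nonsquares being a square.
module Submission where

open import Defs
open import Level using (0ℓ)
open import Data.Nat using (zero; suc; _≤_; _≤?_)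
open import Data.Nat.Divisibility using (_∣_)
import Data.Nat.Properties as ℕ
open import Data.Fin using (Fin; toℕ; punchOut)
open import Data.Fin.Properties using (any?; punchOut-injective; <⇒notInjective; toℕ-injective)
open import Data.Product using (∃; _,_)
open import Data.Empty using (⊥)
open import Data.Sum using (_⊎_; inj₁; inj₂)
open import Function.Bundles using (Inverse)
open import Function.Definitions using (Injective)
open import Function.Base using (_∘_)
open import Data.Fin.Permutation using (Permutation; permutation)
open import Relation.Nullary using (¬_; yes; no; Dec; contradiction)
open import Relation.Binary.PropositionalEquality
  using (_≡_; _≢_; refl; sym; trans; cong; cong₂; subst; module ≡-Reasoning)
open import Algebra.Bundles using (CommutativeRing)
import Algebra.Properties.Ring as RingProperties
import Relation.Binary.Reasoning.Setoid
import Algebra.Solver.CommutativeMonoid as CommutativeMonoidSolver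

Fin-injective⇒surjective : ∀ {n} (g : Fin n → Fin n) → Injective _≡_ _≡_ g →
                           ∀ t → ∃ λ i → g i ≡ t
Fin-injective⇒surjective {suc n} g g-inj t with any? (λ i → g i Data.Fin.≟ t)
... | yes hit = hit
... | no miss = contradiction
      (λ {i} {j} eq → g-inj (punchOut-injective (≢t i) (≢t j) eq))
      (<⇒notInjective {f = λ i → punchOut (≢t i)} (ℕ.n<1+n n))
  where
  ≢t : ∀ i → t ≢ g i
  ≢t i eq = miss (i , sym eq)

module FieldProperties (F : FiniteField) where
  open FiniteField F renaming (Carrier to K)
  open ≡-Reasoning

  commutativeRing : CommutativeRing 0ℓ 0ℓ
  commutativeRing = record
    { Carrier = K ; _≈_ = _≡_ ; _+_ = _+_ ; _*_ = _*_ ; -_ = -_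
    ; 0# = 0# ; 1# = 1# ; isCommutativeRing = isCommutativeRing }

  open CommutativeRing commutativeRing
    using ( +-comm; +-assoc; +-identityˡ; +-identityʳ; -‿inverseˡ; -‿inverseʳ
          ; *-comm; *-assoc; *-identityˡ; *-identityʳ; zeroˡ; zeroʳ; distribˡ)
  open RingProperties (CommutativeRing.ring commutativeRing)
    using ([y-z]x≈yx-zx; -0#≈0#; -‿involutive; x∙y⁻¹≈ε⇒x≈y; +-inverseˡ-unique)
  open CommutativeMonoidSolver (CommutativeRing.*-commutativeMonoid commutativeRing)
    using (solve; _⊜_) renaming (_⊕_ to _⊗_)

  index : K → Fin q
  index = Inverse.to enum

  elem-index : ∀ x → elem (index x) ≡ x
  elem-index x = Inverse.inverseʳ enum refl

  index-elem : ∀ i → index (elem i) ≡ i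
  index-elem i = Inverse.inverseˡ enum refl

  elem-injective : Injective _≡_ _≡_ elem
  elem-injective {i} {j} eq = trans (sym (index-elem i)) (trans (cong index eq) (index-elem j))

  index-injective : Injective _≡_ _≡_ index
  index-injective {x} {y} eq = trans (sym (elem-index x)) (trans (cong elem eq) (elem-index y))

  injective⇒surjective : (h : K → K) → Injective _≡_ _≡_ h → ∀ t → ∃ λ x → h x ≡ t
  injective⇒surjective h h-inj t
    with i , eq ← Fin-injective⇒surjective (λ i → index (h (elem i)))
                    (λ eq → elem-injective (h-inj (index-injective eq))) (index t)
    = elem i , index-injective eq

  ⁻¹-inverseˡ : ∀ {x} → x ≢ 0# → x ⁻¹ * x ≡ 1#
  ⁻¹-inverseˡ {x} x≢0 = trans (*-comm _ _) (⁻¹-inverse x x≢0)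

  *-cancelˡ : ∀ {a u v} → a ≢ 0# → a * u ≡ a * v → u ≡ v
  *-cancelˡ {a} {u} {v} a≢0 eq = begin
    u                ≡⟨ sym (*-identityˡ u) ⟩
    1# * u           ≡⟨ cong (_* u) (sym (⁻¹-inverseˡ a≢0)) ⟩
    (a ⁻¹ * a) * u   ≡⟨ *-assoc _ _ _ ⟩
    a ⁻¹ * (a * u)   ≡⟨ cong (a ⁻¹ *_) eq ⟩
    a ⁻¹ * (a * v)   ≡⟨ sym (*-assoc _ _ _) ⟩
    (a ⁻¹ * a) * v   ≡⟨ cong (_* v) (⁻¹-inverseˡ a≢0) ⟩
    1# * v           ≡⟨ *-identityˡ v ⟩
    v                ∎

  *-≢0 : ∀ {x y} → x ≢ 0# → y ≢ 0# → x * y ≢ 0#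
  *-≢0 {x} {y} x≢0 y≢0 xy≡0 = y≢0 (*-cancelˡ x≢0 (trans xy≡0 (sym (zeroʳ x))))

  ⁻¹-≢0 : ∀ {x} → x ≢ 0# → x ⁻¹ ≢ 0#
  ⁻¹-≢0 {x} x≢0 x⁻¹≡0 = 0≢1 (begin
    0#           ≡⟨ sym (zeroʳ x) ⟩
    x * 0#       ≡⟨ cong (x *_) (sym x⁻¹≡0) ⟩
    x * x ⁻¹     ≡⟨ ⁻¹-inverse x x≢0 ⟩
    1#           ∎)

  ⁻¹-unique : ∀ {x y} → x * y ≡ 1# → y ≡ x ⁻¹
  ⁻¹-unique {x} {y} xy≡1 with x ≟ 0#
  ... | yes refl = contradiction (trans (sym (zeroˡ y)) xy≡1) 0≢1
  ... | no x≢0   = *-cancelˡ x≢0 (trans xy≡1 (sym (⁻¹-inverse x x≢0)))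

  ⁻¹-involutive : ∀ x → x ⁻¹ ⁻¹ ≡ x
  ⁻¹-involutive x with x ≟ 0#
  ... | yes refl = trans (cong _⁻¹ ⁻¹-zero) ⁻¹-zero
  ... | no x≢0   = sym (⁻¹-unique (⁻¹-inverseˡ x≢0))

  ⁻¹-distrib-* : ∀ x y → (x * y) ⁻¹ ≡ x ⁻¹ * y ⁻¹
  ⁻¹-distrib-* x y with x ≟ 0# | y ≟ 0#
  ... | yes refl | _ = trans (cong _⁻¹ (zeroˡ y)) (trans ⁻¹-zero
                         (sym (trans (cong (_* y ⁻¹) ⁻¹-zero) (zeroˡ _))))
  ... | no _ | yes refl = trans (cong _⁻¹ (zeroʳ x)) (trans ⁻¹-zero
                            (sym (trans (cong (x ⁻¹ *_) ⁻¹-zero) (zeroʳ _))))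
  ... | no x≢0 | no y≢0 = sym (⁻¹-unique (begin
    (x * y) * (x ⁻¹ * y ⁻¹)    ≡⟨ solve 4 (λ a b c d → ((a ⊗ b) ⊗ (c ⊗ d)) ⊜ ((a ⊗ c) ⊗ (b ⊗ d)))
                                    refl x y (x ⁻¹) (y ⁻¹) ⟩
    (x * x ⁻¹) * (y * y ⁻¹)    ≡⟨ cong₂ _*_ (⁻¹-inverse x x≢0) (⁻¹-inverse y y≢0) ⟩
    1# * 1#                    ≡⟨ *-identityˡ 1# ⟩
    1#                         ∎))

  square-roots : ∀ {x y} → x * x ≡ y * y → x ≡ y ⊎ x ≡ - y
  square-roots {x} {y} x²≡y² with (x - y) ≟ 0#
  ... | yes x-y≡0 = inj₁ (x∙y⁻¹≈ε⇒x≈y x y x-y≡0)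
  ... | no x-y≢0  = inj₂ (+-inverseˡ-unique x y (*-cancelˡ x-y≢0 (begin
    (x - y) * (x + y)                  ≡⟨ [y-z]x≈yx-zx (x + y) x y ⟩
    x * (x + y) - y * (x + y)          ≡⟨ cong₂ _-_ (distribˡ x x y) (distribˡ y x y) ⟩
    (x * x + x * y) - (y * x + y * y)  ≡⟨ cong₂ (λ u v → (u + v) - (y * x + y * y)) x²≡y² (*-comm x y) ⟩
    (y * y + y * x) - (y * x + y * y)  ≡⟨ cong (λ v → (y * y + y * x) - v) (+-comm (y * x) (y * y)) ⟩
    (y * y + y * x) - (y * y + y * x)  ≡⟨ -‿inverseʳ _ ⟩
    0#                                 ≡⟨ sym (zeroʳ (x - y)) ⟩
    (x - y) * 0#                       ∎)))

  x≢y⇒x-y≢0 : ∀ {x y} → x ≢ y → x - y ≢ 0#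
  x≢y⇒x-y≢0 {x} {y} x≢y x-y≡0 = x≢y (x∙y⁻¹≈ε⇒x≈y x y x-y≡0)

  x-y+y-z≡x-z : ∀ x y z → (x - y) + (y - z) ≡ x - z
  x-y+y-z≡x-z x y z = begin
    (x - y) + (y - z)     ≡⟨ +-assoc x (- y) (y - z) ⟩
    x + (- y + (y - z))   ≡⟨ cong (x +_) (sym (+-assoc (- y) y (- z))) ⟩
    x + ((- y + y) - z)   ≡⟨ cong (λ t → x + (t - z)) (-‿inverseˡ y) ⟩
    x + (0# - z)          ≡⟨ cong (x +_) (+-identityˡ (- z)) ⟩
    x - z                 ∎

  IsSquare : K → Set
  IsSquare x = ∃ λ s → s * s ≡ x

  isSquare? : ∀ x → Dec (IsSquare x)
  isSquare? x with any? (λ i → (elem i * elem i) ≟ x)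
  ... | yes (i , eq) = yes (elem i , eq)
  ... | no none      = no λ (s , eq) →
      none (index s , subst (λ t → t * t ≡ x) (sym (elem-index s)) eq)

  square-* : ∀ {x y} → IsSquare x → IsSquare y → IsSquare (x * y)
  square-* {x} {y} (s , s²≡x) (t , t²≡y) = s * t , (begin
    (s * t) * (s * t)   ≡⟨ solve 2 (λ s t → ((s ⊗ t) ⊗ (s ⊗ t)) ⊜ ((s ⊗ s) ⊗ (t ⊗ t))) refl s t ⟩
    (s * s) * (t * t)   ≡⟨ cong₂ _*_ s²≡x t²≡y ⟩
    x * y               ∎)

  square-⁻¹ : ∀ {x} → IsSquare x → IsSquare (x ⁻¹)
  square-⁻¹ (s , s²≡x) = s ⁻¹ , trans (sym (⁻¹-distrib-* s s)) (cong _⁻¹ s²≡x)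

  square-cancelˡ : ∀ {x y} → x ≢ 0# → IsSquare x → IsSquare (x * y) → IsSquare y
  square-cancelˡ {x} {y} x≢0 □x □xy = subst IsSquare (begin
    x ⁻¹ * (x * y)   ≡⟨ sym (*-assoc _ _ _) ⟩
    (x ⁻¹ * x) * y   ≡⟨ cong (_* y) (⁻¹-inverseˡ x≢0) ⟩
    1# * y           ≡⟨ *-identityˡ y ⟩
    y                ∎) (square-* (square-⁻¹ □x) □xy)

  nonSquare-≢0 : ∀ {x} → ¬ IsSquare x → x ≢ 0#
  nonSquare-≢0 ¬□x refl = ¬□x (0# , zeroˡ 0#)

  nonSquare≢square-scaled : ∀ {a x y} → ¬ IsSquare a → y ≢ 0# → x * x ≢ a * (y * y)
  nonSquare≢square-scaled {a} {x} {y} ¬□a y≢0 x²≡ay² = ¬□a (square-cancelˡ (*-≢0 y≢0 y≢0) (y , refl)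
    (subst IsSquare (trans x²≡ay² (*-comm a (y * y))) (x , refl)))

  -- x is "positive" if it precedes -x in the enumeration; this picks one of ±x for x ≢ 0.
  Positive : K → Set
  Positive x = toℕ (index x) ≤ toℕ (index (- x))

  positive? : ∀ x → Dec (Positive x)
  positive? x = toℕ (index x) ≤? toℕ (index (- x))

  nonPositive⇒≢0 : ∀ {x} → ¬ Positive x → x ≢ 0#
  nonPositive⇒≢0 {x} ¬+x refl = ¬+x (subst (λ t → toℕ (index 0#) ≤ toℕ (index t)) (sym -0#≈0#) ℕ.≤-refl)

  positive-opposites : ∀ y → Positive (- y) → Positive y → - y ≡ y
  positive-opposites y +-y +y = index-injective (toℕ-injective (ℕ.≤-antisym
    (subst (λ t → toℕ (index (- y)) ≤ toℕ (index t)) (-‿involutive y) +-y) +y))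

  nonPositive-opposites : ∀ y → ¬ Positive (- y) → ¬ Positive y → ⊥
  nonPositive-opposites y ¬+-y ¬+y with ℕ.≤-total (toℕ (index y)) (toℕ (index (- y)))
  ... | inj₁ y≤-y = ¬+y y≤-y
  ... | inj₂ -y≤y = ¬+-y (subst (λ t → toℕ (index (- y)) ≤ toℕ (index t)) (sym (-‿involutive y)) -y≤y)

  -- For a nonsquare a, x ↦ x² on positive x and x ↦ a x² otherwise is injective, hence
  -- surjective; so every nonsquare is a times a square.
  squareOrScaled : K → (x : K) → Dec (Positive x) → K
  squareOrScaled a x (yes _) = x * x
  squareOrScaled a x (no _)  = a * (x * x)

  squareOrScaled-injective : ∀ {a} → ¬ IsSquare a → ∀ x y (±x : Dec (Positive x)) (±y : Dec (Positive y)) →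
                             squareOrScaled a x ±x ≡ squareOrScaled a y ±y → x ≡ y
  squareOrScaled-injective ¬□a x y (yes +x) (yes +y) eq with square-roots eq
  ... | inj₁ x≡y  = x≡y
  ... | inj₂ refl = positive-opposites y +x +y
  squareOrScaled-injective ¬□a x y (no ¬+x) (no ¬+y) eq with square-roots (*-cancelˡ (nonSquare-≢0 ¬□a) eq)
  ... | inj₁ x≡y  = x≡y
  ... | inj₂ refl = contradiction ¬+y (nonPositive-opposites y ¬+x)
  squareOrScaled-injective ¬□a x y (yes _) (no ¬+y) eq =
    contradiction eq (nonSquare≢square-scaled ¬□a (nonPositive⇒≢0 ¬+y))
  squareOrScaled-injective ¬□a x y (no ¬+x) (yes _) eq =
    contradiction (sym eq) (nonSquare≢square-scaled ¬□a (nonPositive⇒≢0 ¬+x))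

  nonSquare-*-nonSquare : ∀ {a b} → ¬ IsSquare a → ¬ IsSquare b → IsSquare (a * b)
  nonSquare-*-nonSquare {a} {b} ¬□a ¬□b
    with x , eq ← injective⇒surjective (λ x → squareOrScaled a x (positive? x))
                    (λ {x} {y} → squareOrScaled-injective ¬□a x y (positive? x) (positive? y)) b
    = fromPreimage (positive? x) eq
    where
    fromPreimage : ∀ {x} (±x : Dec (Positive x)) → squareOrScaled a x ±x ≡ b → IsSquare (a * b)
    fromPreimage {x} (yes _) x²≡b  = contradiction (x , x²≡b) ¬□b
    fromPreimage {x} (no _)  ax²≡b = a * x , (begin
      (a * x) * (a * x)   ≡⟨ solve 2 (λ a x → ((a ⊗ x) ⊗ (a ⊗ x)) ⊜ (a ⊗ (a ⊗ (x ⊗ x)))) refl a x ⟩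
      a * (a * (x * x))   ≡⟨ cong (a *_) ax²≡b ⟩
      a * b               ∎)

module CharacterProperties (F : FiniteField) (R : CommutativeRing 0ℓ 0ℓ) where
  private module K = FiniteField F
  open K using (_⁻¹; _≟_)
  open FieldProperties F
  private module Kᴿ = CommutativeRing commutativeRing
  open CommutativeRing R
    renaming (refl to ≈-refl; sym to ≈-sym; trans to ≈-trans; reflexive to ≈-reflexive)
  open RingProperties ring using (-1*x≈-x; -‿involutive)
  open CommutativeMonoidSolver *-commutativeMonoid using (solve; _⊜_) renaming (_⊕_ to _⊗_)
  open Relation.Binary.Reasoning.Setoid setoid

  Multiplicative : (K.Carrier → Carrier) → Set
  Multiplicative f = ∀ x y → f (x K.* y) ≈ f x * f y

  twist : (K.Carrier → Carrier) → K.Carrier → Carrier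
  twist χ = _·_ F R (φ F R) (conj F R χ)

  φ-0 : φ F R K.0# ≈ 0#
  φ-0 with K.0# ≟ K.0#
  ... | yes _   = ≈-refl
  ... | no 0≢0 = contradiction refl 0≢0

  φ-square : ∀ {x} → x ≢ K.0# → IsSquare x → φ F R x ≈ 1#
  φ-square {x} x≢0 (s , s²≡x) with x ≟ K.0#
  ... | yes x≡0 = contradiction x≡0 x≢0
  ... | no _ with any? (λ i → (K.elem i K.* K.elem i) ≟ x)
  ...   | yes _ = ≈-refl
  ...   | no none = contradiction
          (index s , subst (λ t → t K.* t ≡ x) (sym (elem-index s)) s²≡x) none

  φ-nonSquare : ∀ {x} → ¬ IsSquare x → φ F R x ≈ - 1#
  φ-nonSquare {x} ¬□x with x ≟ K.0#
  ... | yes x≡0 = contradiction x≡0 (nonSquare-≢0 ¬□x)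
  ... | no _ with any? (λ i → (K.elem i K.* K.elem i) ≟ x)
  ...   | yes (i , eq) = contradiction (K.elem i , eq) ¬□x
  ...   | no _         = ≈-refl

  φ-≡0 : ∀ {x} → x ≡ K.0# → φ F R x ≈ 0#
  φ-≡0 refl = φ-0

  -1*-1≈1 : - 1# * - 1# ≈ 1#
  -1*-1≈1 = ≈-trans (-1*x≈-x (- 1#)) (-‿involutive 1#)

  φ-multiplicative-≢0 : ∀ {x y} → x ≢ K.0# → y ≢ K.0# → φ F R (x K.* y) ≈ φ F R x * φ F R y
  φ-multiplicative-≢0 {x} {y} x≢0 y≢0 with isSquare? x | isSquare? y
  ... | yes □x | yes □y = ≈-trans (φ-square (*-≢0 x≢0 y≢0) (square-* □x □y))
        (≈-sym (≈-trans (*-cong (φ-square x≢0 □x) (φ-square y≢0 □y)) (*-identityˡ 1#)))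
  ... | yes □x | no ¬□y = ≈-trans (φ-nonSquare (¬□y ∘ square-cancelˡ x≢0 □x))
        (≈-sym (≈-trans (*-cong (φ-square x≢0 □x) (φ-nonSquare ¬□y)) (*-identityˡ (- 1#))))
  ... | no ¬□x | yes □y =
        ≈-trans (φ-nonSquare (¬□x ∘ square-cancelˡ y≢0 □y ∘ subst IsSquare (Kᴿ.*-comm x y)))
        (≈-sym (≈-trans (*-cong (φ-nonSquare ¬□x) (φ-square y≢0 □y)) (*-identityʳ (- 1#))))
  ... | no ¬□x | no ¬□y = ≈-trans (φ-square (*-≢0 x≢0 y≢0) (nonSquare-*-nonSquare ¬□x ¬□y))
        (≈-sym (≈-trans (*-cong (φ-nonSquare ¬□x) (φ-nonSquare ¬□y)) -1*-1≈1))

  φ-multiplicative : Multiplicative (φ F R)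
  φ-multiplicative x y = byZero (x ≟ K.0#) (y ≟ K.0#)
    where
    byZero : Dec (x ≡ K.0#) → Dec (y ≡ K.0#) → φ F R (x K.* y) ≈ φ F R x * φ F R y
    byZero (yes x≡0) _ = begin
      φ F R (x K.* y)     ≈⟨ φ-≡0 (trans (cong (K._* y) x≡0) (Kᴿ.zeroˡ y)) ⟩
      0#                  ≈⟨ zeroˡ _ ⟨
      0# * φ F R y        ≈⟨ *-congʳ (φ-≡0 x≡0) ⟨
      φ F R x * φ F R y   ∎
    byZero (no _) (yes y≡0) = begin
      φ F R (x K.* y)     ≈⟨ φ-≡0 (trans (cong (x K.*_) y≡0) (Kᴿ.zeroʳ x)) ⟩
      0#                  ≈⟨ zeroʳ _ ⟨
      φ F R x * 0#        ≈⟨ *-congˡ (φ-≡0 y≡0) ⟨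
      φ F R x * φ F R y   ∎
    byZero (no x≢0) (no y≢0) = φ-multiplicative-≢0 x≢0 y≢0

  φ-1 : φ F R K.1# ≈ 1#
  φ-1 = φ-square (K.0≢1 ∘ sym) (K.1# , Kᴿ.*-identityˡ K.1#)

  φ²≈1 : ∀ {x} → x ≢ K.0# → φ F R x * φ F R x ≈ 1#
  φ²≈1 {x} x≢0 = ≈-trans (≈-sym (φ-multiplicative x x)) (φ-square (*-≢0 x≢0 x≢0) (x , refl))

  conj-multiplicative : ∀ {f} → Multiplicative f → Multiplicative (conj F R f)
  conj-multiplicative {f} f-mul x y = ≈-trans (≈-reflexive (cong f (⁻¹-distrib-* x y))) (f-mul _ _)

  ·-multiplicative : ∀ {f g} → Multiplicative f → Multiplicative g → Multiplicative (_·_ F R f g)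
  ·-multiplicative {f} {g} f-mul g-mul x y = ≈-trans (*-cong (f-mul x y) (g-mul x y))
    (solve 4 (λ a b c d → ((a ⊗ b) ⊗ (c ⊗ d)) ⊜ ((a ⊗ c) ⊗ (b ⊗ d))) ≈-refl (f x) (f y) (g x) (g y))

  twist-multiplicative : ∀ {χ} → Multiplicative χ → Multiplicative (twist χ)
  twist-multiplicative χ-mul = ·-multiplicative φ-multiplicative (conj-multiplicative χ-mul)

  *-conj≈1 : ∀ {f} → Multiplicative f → f K.1# ≈ 1# → ∀ {x} → x ≢ K.0# → f x * conj F R f x ≈ 1#
  *-conj≈1 {f} f-mul f-1 {x} x≢0 = begin
    f x * f (x ⁻¹)   ≈⟨ f-mul x (x ⁻¹) ⟨
    f (x K.* x ⁻¹)   ≡⟨ cong f (K.⁻¹-inverse x x≢0) ⟩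
    f K.1#           ≈⟨ f-1 ⟩
    1#               ∎

  twist-0 : ∀ χ → twist χ K.0# ≈ 0#
  twist-0 χ = ≈-trans (*-congʳ φ-0) (zeroˡ _)

  twist² : ∀ χ {x} → x ≢ K.0# → twist χ x * twist χ x ≈ conj F R χ x * conj F R χ x
  twist² χ {x} x≢0 = begin
    (φ F R x * χ̄ x) * (φ F R x * χ̄ x)   ≈⟨ solve 2 (λ a b → ((a ⊗ b) ⊗ (a ⊗ b)) ⊜ ((a ⊗ a) ⊗ (b ⊗ b)))
                                              ≈-refl (φ F R x) (χ̄ x) ⟩
    (φ F R x * φ F R x) * (χ̄ x * χ̄ x)   ≈⟨ *-congʳ (φ²≈1 x≢0) ⟩
    1# * (χ̄ x * χ̄ x)                   ≈⟨ *-identityˡ _ ⟩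
    χ̄ x * χ̄ x                          ∎
    where χ̄ = conj F R χ

  twist-involutive : (η : Character F R) → ∀ x → twist (twist (Character.χ η)) x ≈ Character.χ η x
  twist-involutive η x = byZero (x ≟ K.0#)
    where
    open Character η
    byZero : Dec (x ≡ K.0#) → twist (twist χ) x ≈ χ x
    byZero (yes refl) = begin
      φ F R K.0# * twist χ (K.0# ⁻¹)   ≈⟨ *-congʳ φ-0 ⟩
      0# * twist χ (K.0# ⁻¹)           ≈⟨ zeroˡ _ ⟩
      0#                               ≈⟨ χ-0 ⟨
      χ K.0#                           ∎
    byZero (no x≢0) = begin
      φ F R x * (φ F R (x ⁻¹) * χ (x ⁻¹ ⁻¹))   ≈⟨ *-assoc _ _ _ ⟨
      (φ F R x * φ F R (x ⁻¹)) * χ (x ⁻¹ ⁻¹)   ≈⟨ *-cong (*-conj≈1 φ-multiplicative φ-1 x≢0)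
                                                         (≈-reflexive (cong χ (⁻¹-involutive x))) ⟩
      1# * χ x                                 ≈⟨ *-identityˡ _ ⟩
      χ x                                      ∎

module Sums (F : FiniteField) (R : CommutativeRing 0ℓ 0ℓ) where
  private module K = FiniteField F
  open FieldProperties F using (index; elem-index; index-elem)
  open CommutativeRing R using (Carrier; _≈_; _+_; _*_; semiring; setoid)
  open import Algebra.Properties.Semiring.Sum semiring
    using (sum; sum-cong-≋; sum-cong-≗; sum-permute; *-distribˡ-sum)
  open Relation.Binary.Reasoning.Setoid setoid

  sumFin≡sum : ∀ n (f : Fin n → Carrier) → sumFin F R n f ≡ sum f
  sumFin≡sum zero    f = refl
  sumFin≡sum (suc n) f = cong (f Fin.zero +_) (sumFin≡sum n (λ i → f (Fin.suc i)))

  sumF≡sum : ∀ f → sumF F R f ≡ sum (λ i → f (K.elem i))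
  sumF≡sum f = sumFin≡sum K.q (λ i → f (K.elem i))

  sumF-cong : ∀ {f g} → (∀ x → f x ≈ g x) → sumF F R f ≈ sumF F R g
  sumF-cong {f} {g} f≈g = begin
    sumF F R f                ≡⟨ sumF≡sum f ⟩
    sum (λ i → f (K.elem i))  ≈⟨ sum-cong-≋ (λ i → f≈g (K.elem i)) ⟩
    sum (λ i → g (K.elem i))  ≡⟨ sumF≡sum g ⟨
    sumF F R g                ∎

  *-distribˡ-sumF : ∀ c f → c * sumF F R f ≈ sumF F R (λ x → c * f x)
  *-distribˡ-sumF c f = begin
    c * sumF F R f                  ≡⟨ cong (c *_) (sumF≡sum f) ⟩
    c * sum (λ i → f (K.elem i))    ≈⟨ *-distribˡ-sum c (λ i → f (K.elem i)) ⟩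
    sum (λ i → c * f (K.elem i))    ≡⟨ sumF≡sum (λ x → c * f x) ⟨
    sumF F R (λ x → c * f x)        ∎

  sumF-involution : (σ : K.Carrier → K.Carrier) → (∀ y → σ (σ y) ≡ y) →
                    ∀ f → sumF F R f ≈ sumF F R (f ∘ σ)
  sumF-involution σ σ-involutive f = begin
    sumF F R f                          ≡⟨ sumF≡sum f ⟩
    sum (λ i → f (K.elem i))            ≈⟨ sum-permute (λ i → f (K.elem i)) π ⟩
    sum (λ i → f (K.elem (π̂ i)))        ≡⟨ sum-cong-≗ (λ i → cong f (elem-index (σ (K.elem i)))) ⟩
    sum (λ i → f (σ (K.elem i)))        ≡⟨ sumF≡sum (f ∘ σ) ⟨
    sumF F R (f ∘ σ)                    ∎
    where
    π̂ : Fin K.q → Fin K.q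
    π̂ i = index (σ (K.elem i))
    π̂-involutive : ∀ i → π̂ (π̂ i) ≡ i
    π̂-involutive i = trans (cong (index ∘ σ) (elem-index _))
                       (trans (cong index (σ-involutive (K.elem i))) (index-elem i))
    π : Permutation K.q K.q
    π = permutation π̂ π̂ π̂-involutive π̂-involutive

module Substitution (F : FiniteField) (z : FiniteField.Carrier F) (z≢1 : z ≢ FiniteField.1# F) where
  open FiniteField F renaming (Carrier to K)
  open FieldProperties F
  open CommutativeRing commutativeRing using (*-comm; *-assoc; *-identityʳ; +-comm; -‿inverseʳ)
  open RingProperties (CommutativeRing.ring commutativeRing) using (x[y-z]≈xy-xz; [y-z]x≈yx-zx; ⁻¹-anti-homo‿-)
  open ≡-Reasoning

  σ : K → K
  σ y with y ≟ 1#
  ... | yes _ = 1#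
  ... | no _  = (y - z) * (y - 1#) ⁻¹

  σ-1 : σ 1# ≡ 1#
  σ-1 with 1# ≟ 1#
  ... | yes _   = refl
  ... | no 1≢1 = contradiction refl 1≢1

  σ-≢1 : ∀ {y} → y ≢ 1# → σ y ≡ (y - z) * (y - 1#) ⁻¹
  σ-≢1 {y} y≢1 with y ≟ 1#
  ... | yes y≡1 = contradiction y≡1 y≢1
  ... | no _    = refl

  1-z≢0 : 1# - z ≢ 0#
  1-z≢0 = x≢y⇒x-y≢0 (z≢1 ∘ sym)

  σ[y]-1 : ∀ {y} → y ≢ 1# → σ y - 1# ≡ (1# - z) * (y - 1#) ⁻¹
  σ[y]-1 {y} y≢1 = begin
    σ y - 1#                        ≡⟨ cong (_- 1#) (σ-≢1 y≢1) ⟩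
    (y - z) * i - 1#                ≡⟨ cong (λ t → (y - z) * i - t) (sym (⁻¹-inverse (y - 1#) d≢0)) ⟩
    (y - z) * i - (y - 1#) * i      ≡⟨ [y-z]x≈yx-zx i (y - z) (y - 1#) ⟨
    ((y - z) - (y - 1#)) * i        ≡⟨ cong (λ t → ((y - z) + t) * i) (⁻¹-anti-homo‿- y 1#) ⟩
    ((y - z) + (1# - y)) * i        ≡⟨ cong (_* i) (trans (+-comm (y - z) (1# - y)) (x-y+y-z≡x-z 1# y z)) ⟩
    (1# - z) * i                    ∎
    where
    i = (y - 1#) ⁻¹
    d≢0 = x≢y⇒x-y≢0 y≢1

  σ[y]-z : ∀ {y} → y ≢ 1# → σ y - z ≡ y * ((1# - z) * (y - 1#) ⁻¹)
  σ[y]-z {y} y≢1 = begin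
    σ y - z                         ≡⟨ cong (_- z) (σ-≢1 y≢1) ⟩
    (y - z) * i - z                 ≡⟨ cong (λ t → (y - z) * i - t) z≡z[y-1]i ⟩
    (y - z) * i - (z * (y - 1#)) * i ≡⟨ [y-z]x≈yx-zx i (y - z) (z * (y - 1#)) ⟨
    ((y - z) - z * (y - 1#)) * i    ≡⟨ cong (_* i) y-z-z[y-1]≡y[1-z] ⟩
    (y * (1# - z)) * i              ≡⟨ *-assoc y (1# - z) i ⟩
    y * ((1# - z) * i)              ∎
    where
    i = (y - 1#) ⁻¹
    z≡z[y-1]i : z ≡ (z * (y - 1#)) * i
    z≡z[y-1]i = sym (trans (*-assoc z (y - 1#) i)
                  (trans (cong (z *_) (⁻¹-inverse (y - 1#) (x≢y⇒x-y≢0 y≢1))) (*-identityʳ z)))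
    y-z-z[y-1]≡y[1-z] : (y - z) - z * (y - 1#) ≡ y * (1# - z)
    y-z-z[y-1]≡y[1-z] = begin
      (y - z) - z * (y - 1#)         ≡⟨ cong (λ t → (y - z) - t) (x[y-z]≈xy-xz z y 1#) ⟩
      (y - z) - (z * y - z * 1#)     ≡⟨ cong (λ t → (y - z) - (z * y - t)) (*-identityʳ z) ⟩
      (y - z) - (z * y - z)          ≡⟨ cong ((y - z) +_) (⁻¹-anti-homo‿- (z * y) z) ⟩
      (y - z) + (z - z * y)          ≡⟨ x-y+y-z≡x-z y z (z * y) ⟩
      y - z * y                      ≡⟨ cong₂ _-_ (sym (*-identityʳ y)) (*-comm z y) ⟩
      y * 1# - y * z                 ≡⟨ x[y-z]≈xy-xz y 1# z ⟨
      y * (1# - z)                   ∎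

  σ-involutive-≢1 : ∀ {y} → y ≢ 1# → σ (σ y) ≡ y
  σ-involutive-≢1 {y} y≢1 = begin
    σ (σ y)                          ≡⟨ σ-≢1 σy≢1 ⟩
    (σ y - z) * (σ y - 1#) ⁻¹        ≡⟨ cong₂ (λ a b → a * b ⁻¹) (σ[y]-z y≢1) (σ[y]-1 y≢1) ⟩
    (y * u) * u ⁻¹                   ≡⟨ *-assoc y u (u ⁻¹) ⟩
    y * (u * u ⁻¹)                   ≡⟨ cong (y *_) (⁻¹-inverse u u≢0) ⟩
    y * 1#                           ≡⟨ *-identityʳ y ⟩
    y                                ∎
    where
    u = (1# - z) * (y - 1#) ⁻¹
    u≢0 : u ≢ 0#
    u≢0 = *-≢0 1-z≢0 (⁻¹-≢0 (x≢y⇒x-y≢0 y≢1))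
    σy≢1 : σ y ≢ 1#
    σy≢1 σy≡1 = u≢0 (trans (sym (σ[y]-1 y≢1)) (trans (cong (_- 1#) σy≡1) (-‿inverseʳ 1#)))

  σ-involutive : ∀ y → σ (σ y) ≡ y
  σ-involutive y = byOne (y ≟ 1#)
    where
    byOne : Dec (y ≡ 1#) → σ (σ y) ≡ y
    byOne (yes y≡1) = trans (cong (σ ∘ σ) y≡1) (trans (cong σ σ-1) (trans σ-1 (sym y≡1)))
    byOne (no y≢1)  = σ-involutive-≢1 y≢1

module Summands (F : FiniteField) (R : CommutativeRing 0ℓ 0ℓ) (η : Character F R)
                (z : FiniteField.Carrier F) (z≢1 : z ≢ FiniteField.1# F) where
  private module K = FiniteField F
  open K using (_⁻¹; _≟_)
  open FieldProperties F using (commutativeRing; ⁻¹-involutive; ⁻¹-≢0; *-≢0; x≢y⇒x-y≢0)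
  private module Kᴿ = CommutativeRing commutativeRing
  open CharacterProperties F R
  open Substitution F z z≢1
  open Character η
  open CommutativeRing R
    renaming (refl to ≈-refl; trans to ≈-trans; reflexive to ≈-reflexive)
  open CommutativeMonoidSolver *-commutativeMonoid using (solve; _⊜_) renaming (_⊕_ to _⊗_)
  open Relation.Binary.Reasoning.Setoid setoid

  summand : (K.Carrier → Carrier) → K.Carrier → Carrier
  summand ξ x = (ξ x * twist ξ (x K.- K.1#)) * twist ξ (x K.- z)

  ψ : K.Carrier → Carrier
  ψ = twist χ

  χ̄[1-z]² : Carrier
  χ̄[1-z]² = conj F R χ (K.1# K.- z) * conj F R χ (K.1# K.- z)

  summand-1 : ∀ ξ → summand ξ K.1# ≈ 0#
  summand-1 ξ = begin
    (ξ K.1# * twist ξ (K.1# K.- K.1#)) * twist ξ (K.1# K.- z)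
      ≡⟨ cong (λ t → (ξ K.1# * twist ξ t) * twist ξ (K.1# K.- z)) (Kᴿ.-‿inverseʳ K.1#) ⟩
    (ξ K.1# * twist ξ K.0#) * twist ξ (K.1# K.- z)
      ≈⟨ *-congʳ (≈-trans (*-congˡ (twist-0 ξ)) (zeroʳ _)) ⟩
    0# * twist ξ (K.1# K.- z)
      ≈⟨ zeroˡ _ ⟩
    0#
      ∎

  summand-twist : ∀ y → summand ψ y ≈ (ψ y * χ (y K.- K.1#)) * χ (y K.- z)
  summand-twist y = *-cong (*-congˡ (twist-involutive η _)) (twist-involutive η _)

  summand-σ-≢1 : ∀ {y} → y ≢ K.1# → summand χ (σ y) ≈ χ̄[1-z]² * summand ψ y
  summand-σ-≢1 {y} y≢1 = begin
    summand χ (σ y)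
      ≡⟨ cong₂ _*_ (cong₂ _*_ (cong χ (σ-≢1 y≢1)) (cong ψ (σ[y]-1 y≢1))) (cong ψ (σ[y]-z y≢1)) ⟩
    (χ (w K.* i) * ψ u) * ψ (y K.* u)
      ≈⟨ *-cong (*-congʳ (χ-mul w i)) (twist-multiplicative χ-mul y u) ⟩
    ((χ w * χ i) * ψ u) * (ψ y * ψ u)
      ≈⟨ solve 4 (λ a b e f → (((a ⊗ b) ⊗ e) ⊗ (f ⊗ e)) ⊜ (((e ⊗ e) ⊗ b) ⊗ (f ⊗ a)))
           ≈-refl (χ w) (χ i) (ψ u) (ψ y) ⟩
    ((ψ u * ψ u) * χ i) * (ψ y * χ w)
      ≈⟨ *-congʳ ψ[u]²χ[i]≈χ̄[1-z]²χ[d] ⟩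
    (χ̄[1-z]² * χ d) * (ψ y * χ w)
      ≈⟨ solve 4 (λ a b e f → ((a ⊗ b) ⊗ (e ⊗ f)) ⊜ (a ⊗ ((e ⊗ b) ⊗ f)))
           ≈-refl χ̄[1-z]² (χ d) (ψ y) (χ w) ⟩
    χ̄[1-z]² * ((ψ y * χ d) * χ w)
      ≈⟨ *-congˡ (summand-twist y) ⟨
    χ̄[1-z]² * summand ψ y
      ∎
    where
    w = y K.- z
    d = y K.- K.1#
    d≢0 : d ≢ K.0#
    d≢0 = x≢y⇒x-y≢0 y≢1
    i = d ⁻¹
    u = (K.1# K.- z) K.* i
    χ̄ = conj F R χ
    χ̄[u]≈χ̄[1-z]χ[d] : χ̄ u ≈ χ̄ (K.1# K.- z) * χ d
    χ̄[u]≈χ̄[1-z]χ[d] = ≈-trans (conj-multiplicative χ-mul (K.1# K.- z) i)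
                                 (*-congˡ (≈-reflexive (cong χ (⁻¹-involutive d))))
    ψ[u]²χ[i]≈χ̄[1-z]²χ[d] : (ψ u * ψ u) * χ i ≈ χ̄[1-z]² * χ d
    ψ[u]²χ[i]≈χ̄[1-z]²χ[d] = begin
      (ψ u * ψ u) * χ i
        ≈⟨ *-congʳ (twist² χ (*-≢0 1-z≢0 (⁻¹-≢0 d≢0))) ⟩
      (χ̄ u * χ̄ u) * χ i
        ≈⟨ *-congʳ (*-cong χ̄[u]≈χ̄[1-z]χ[d] χ̄[u]≈χ̄[1-z]χ[d]) ⟩
      ((χ̄ (K.1# K.- z) * χ d) * (χ̄ (K.1# K.- z) * χ d)) * χ i
        ≈⟨ solve 3 (λ a b e → (((a ⊗ b) ⊗ (a ⊗ b)) ⊗ e) ⊜ ((a ⊗ a) ⊗ (b ⊗ (b ⊗ e))))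
             ≈-refl (χ̄ (K.1# K.- z)) (χ d) (χ i) ⟩
      χ̄[1-z]² * (χ d * (χ d * χ i))
        ≈⟨ *-congˡ (*-congˡ (*-conj≈1 χ-mul χ-1 d≢0)) ⟩
      χ̄[1-z]² * (χ d * 1#)
        ≈⟨ *-congˡ (*-identityʳ _) ⟩
      χ̄[1-z]² * χ d
        ∎

  summand-σ : ∀ y → summand χ (σ y) ≈ χ̄[1-z]² * summand ψ y
  summand-σ y = byOne (y ≟ K.1#)
    where
    byOne : Dec (y ≡ K.1#) → summand χ (σ y) ≈ χ̄[1-z]² * summand ψ y
    byOne (no y≢1)  = summand-σ-≢1 y≢1
    byOne (yes y≡1) = begin
      summand χ (σ y)          ≡⟨ cong (summand χ) (trans (cong σ y≡1) σ-1) ⟩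
      summand χ K.1#           ≈⟨ summand-1 χ ⟩
      0#                       ≈⟨ zeroʳ χ̄[1-z]² ⟨
      χ̄[1-z]² * 0#             ≈⟨ *-congˡ (≈-trans (≈-reflexive (cong (summand ψ) y≡1)) (summand-1 ψ)) ⟨
      χ̄[1-z]² * summand ψ y    ∎

proposition3p1 : (F : FiniteField) (R : CommutativeRing 0ℓ 0ℓ) →
    ¬ (2 ∣ FiniteField.q F) →
    (η : Character F R) → (z : FiniteField.Carrier F) → z ≢ FiniteField.1# F →
    CommutativeRing._≈_ R
      (Fη F R (Character.χ η) z)
      (CommutativeRing._*_ R
        (CommutativeRing._*_ R
          (conj F R (Character.χ η) (FiniteField._-_ F (FiniteField.1# F) z))
          (conj F R (Character.χ η) (FiniteField._-_ F (FiniteField.1# F) z)))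
        (Fη F R (_·_ F R (φ F R) (conj F R (Character.χ η))) z))
proposition3p1 F R _ η z z≢1 = begin
  sumF F R (summand χ)                        ≈⟨ sumF-involution σ σ-involutive (summand χ) ⟩
  sumF F R (summand χ ∘ σ)                    ≈⟨ sumF-cong summand-σ ⟩
  sumF F R (λ y → χ̄[1-z]² * summand ψ y)      ≈⟨ *-distribˡ-sumF χ̄[1-z]² (summand ψ) ⟨
  χ̄[1-z]² * sumF F R (summand ψ)              ∎
  where
  open CommutativeRing R using (_*_; setoid)
  open Relation.Binary.Reasoning.Setoid setoid
  open Sums F R
  open Substitution F z z≢1 using (σ; σ-involutive)
  open Summands F R η z z≢1
  open Character η using (χ)
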